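{- The DCell $D_{2,2}$ is super-$\lambda_3$: every minimum $3$-restricted edge-cut $F$ of $D_{2,2}$ is such that $D_{2,2}-F$ has a component that is a connected subgraph on exactly three vertices (a path of length two).
   Context: DCell $D_{k,n}$ ($n\geq 2$, $k\geq 0$) is defined recursively. $D_{0,n}$ is the complete graph $K_n$ on vertices $0,1,\dots,n-1$. Let $t_{k,n}=|V(D_{k,n})|$. For $k\geq1$, $D_{k,n}$ is built from $t_{k-1,n}+1$ disjoint copies $D^0_{k-1,n},\dots,D^{t_{k-1,n}}_{k-1,n}$ of $D_{k-1,n}$; a vertex of copy $D^i_{k-1,n}$ is labeled $(i,a_{k-1},\dots,a_0)$, and its index within the copy is $uid_{k-1}=a_0+\sum_{l=1}^{k-1}a_l t_{l-1,n}$. For each pair $a<b$ of copy indices, one edge joins the vertex of $D^a_{k-1,n}$ with $uid_{k-1}=b-1$ to the vertex of $D^b_{k-1,n}$ with $uid_{k-1}=a$. Thus $D_{2,2}$ consists of seven $6$-cycles pairwise joined by one edge. An edge set $F$ is an $m$-restricted edge-cut of $G$ if $G-F$ is disconnected and every component has at least $m$ vertices; $G$ is super-$\lambda_m$ if every minimum $m$-restricted edge-cut isolates a connected subgraph on exactly $m$ vertices. -}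

module Defs where

open import Data.Nat using (ℕ; zero; suc; _+_; _*_; _∸_; _≤_; _<_)
open import Data.Product using (Σ; ∃; _×_; _,_)
open import Data.Sum using (_⊎_)
open import Data.List using (List; length)
open import Data.List.Membership.Propositional using (_∈_)
open import Data.List.Relation.Unary.All using (All)
open import Data.List.Relation.Unary.Unique.Propositional using (Unique)
open import Relation.Nullary using (¬_)
open import Relation.Binary.PropositionalEquality using (_≡_; _≢_)
open import Relation.Binary.Construct.Closure.ReflexiveTransitive using (Star)
open import Function.Bundles using (_⇔_)

-- Simple graphs on vertex set {0, …, size-1} given by an adjacency relation

record Graph : Set₁ where
  field
    size : ℕ
    Adj  : ℕ → ℕ → Set
open Graph public

-- DCell D_{k,n}.  Vertices are identified with their uid_k ∈ {0,…,t_{k,n}-1},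
-- where a vertex (i, a_{k-1},…,a_0) of copy D^i_{k-1,n} has
-- uid_k = i * t_{k-1,n} + uid_{k-1}.

t : ℕ → ℕ → ℕ
t zero    n = n
t (suc k) n = t k n * (t k n + 1)

data DAdj : ℕ → ℕ → ℕ → ℕ → Set where
  base  : ∀ {n u v} → u < n → v < n → u ≢ v → DAdj zero n u v
  inner : ∀ {k n i x y} → i ≤ t k n → DAdj k n x y →
          DAdj (suc k) n (i * t k n + x) (i * t k n + y)
  cross : ∀ {k n a b} → a < b → b ≤ t k n →
          DAdj (suc k) n (a * t k n + (b ∸ 1)) (b * t k n + a)
  cross' : ∀ {k n a b} → a < b → b ≤ t k n →
          DAdj (suc k) n (b * t k n + a) (a * t k n + (b ∸ 1))

DCell : ℕ → ℕ → Graph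
DCell k n = record { size = t k n ; Adj = DAdj k n }

IsEdgeSet : Graph → List (ℕ × ℕ) → Set
IsEdgeSet G F = All (λ e → Σ ℕ λ u → Σ ℕ λ v → e ≡ (u , v) × u < v × Adj G u v) F
              × Unique F

InF : List (ℕ × ℕ) → ℕ → ℕ → Set
InF F u v = (u , v) ∈ F ⊎ (v , u) ∈ F

AdjMinus : Graph → List (ℕ × ℕ) → ℕ → ℕ → Set
AdjMinus G F u v = Adj G u v × ¬ InF F u v

Conn : Graph → List (ℕ × ℕ) → ℕ → ℕ → Set
Conn G F = Star (AdjMinus G F)

IsVertex : Graph → ℕ → Set
IsVertex G u = u < size G

Disconnected : Graph → List (ℕ × ℕ) → Set
Disconnected G F = ∃ λ u → ∃ λ v → IsVertex G u × IsVertex G v × ¬ Conn G F u v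

ComponentsAtLeast : ℕ → Graph → List (ℕ × ℕ) → Set
ComponentsAtLeast m G F =
  ∀ u → IsVertex G u →
  Σ (List ℕ) λ L → m ≤ length L × Unique L × All (λ w → IsVertex G w × Conn G F u w) L

RestrictedEdgeCut : ℕ → Graph → List (ℕ × ℕ) → Set
RestrictedEdgeCut m G F = IsEdgeSet G F × Disconnected G F × ComponentsAtLeast m G F

MinRestrictedEdgeCut : ℕ → Graph → List (ℕ × ℕ) → Set
MinRestrictedEdgeCut m G F =
  RestrictedEdgeCut m G F × (∀ F' → RestrictedEdgeCut m G F' → length F ≤ length F')

HasComponentOfSize : ℕ → Graph → List (ℕ × ℕ) → Set
HasComponentOfSize m G F =
  ∃ λ u → IsVertex G u × Σ (List ℕ) λ L → length L ≡ m × Unique L × (∀ w → Conn G F u w ⇔ w ∈ L)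

SuperLambda : ℕ → Graph → Set
SuperLambda m G = ∀ F → MinRestrictedEdgeCut m G F → HasComponentOfSize m G F

module Submission where

-- A minimum 3-restricted edge-cut F has at most five edges, because the five edges leaving the path
-- 0 – 1 – 4 already form one.  Call a hexagon (copy of D_{1,2}) heavy when F contains two of its
-- edges; if F cuts c bridges between hexagons then 2·#heavy + c ≤ 5, so at most two hexagons are
-- heavy.  A light hexagon loses at most one edge and stays connected, and two light hexagons stay
-- joined: they are linked directly and through each of the five other hexagons, and blocking all
-- six routes costs more than the budget.  A vertex of a heavy hexagon reaches the light ones along
-- its own bridge unless that bridge is cut or ends in the other heavy hexagon; checking the possible
-- heavy sets shows that at most three vertices are stranded this way.  As D_{2,2} − F is
-- disconnected, some component misses the light hexagons, so it lies among the stranded vertices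
-- and, having at least three vertices, has exactly three.

open import Defs
open import Data.Bool using (true; false)
open import Data.Empty using (⊥-elim)
open import Data.List
  using (List; []; _∷_; [_]; length; map; filter; concatMap; _++_; upTo; cartesianProduct; cartesianProductWith;
         deduplicate)
open import Data.List.Properties
  using (length-filter; filter-notAll; filter-++; length-++; filter-accept; filter-reject; length-map)
open import Data.List.Membership.Propositional using (_∈_; _∉_; find; lose)
open import Data.List.Membership.Propositional.Properties
  using (∈-filter⁺; ∈-filter⁻; ∈-concatMap⁺; ∈-concatMap⁻; ∈-map⁺; ∈-map⁻; ∈-++⁺ˡ; ∈-++⁺ʳ; ∈-++⁻; ∈-upTo⁺; ∈-upTo⁻;
         ∈-cartesianProduct⁺; ∈-cartesianProduct⁻; ∈-cartesianProductWith⁺; ∈-deduplicate⁻)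
open import Data.List.Relation.Binary.Subset.Propositional using (_⊆_)
open import Data.List.Relation.Unary.All using (All; []; _∷_)
import Data.List.Relation.Unary.All as All
open import Data.List.Relation.Unary.All.Properties using (¬All⇒Any¬)
open import Data.List.Relation.Unary.AllPairs using ([]; _∷_)
open import Data.List.Relation.Unary.Any using (here; there)
import Data.List.Relation.Unary.Any as Any
open import Data.List.Relation.Unary.Unique.Propositional using (Unique)
import Data.List.Relation.Unary.Unique.Propositional.Properties as Unique
open import Data.Nat using (ℕ; zero; suc; _+_; _*_; _∸_; _≤_; _<_; _⊓_; _⊔_; z≤n; s≤s; s≤s⁻¹; _≟_; _<?_; _≤?_)
open import Data.Nat.DivMod using (_/_; _%_; m<n*o⇒m/o<n; m%n<n; m≡m%n+[m/n]*n)
open import Data.Nat.ListAction using (sum)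
open import Data.Nat.Properties
open import Data.Product using (Σ; ∃-syntax; _×_; _,_; proj₁; proj₂; uncurry)
open import Data.Product.Properties using (≡-dec)
open import Data.Sum using (_⊎_; inj₁; inj₂)
open import Function.Base using (_∘_)
open import Function.Bundles using (mk⇔)
open import Relation.Binary.Construct.Closure.ReflexiveTransitive using (Star; ε; _◅_; _◅◅_)
import Relation.Binary.Construct.Closure.ReflexiveTransitive as Star
open import Relation.Binary.Definitions using (DecidableEquality; Symmetric; tri<; tri≈; tri>)
open import Relation.Binary.PropositionalEquality using (_≡_; _≢_; refl; sym; trans; cong; cong₂; subst)
open import Relation.Nullary using (¬_; Dec; yes; no; ¬?; does; contradiction)
open import Relation.Nullary.Decidable using (from-yes; toSum; _×-dec_; _⊎-dec_; _→-dec_)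
open import Data.List.Membership.DecPropositional _≟_ using () renaming (_∈?_ to _∈ℕ?_)
open import Data.List.Membership.DecPropositional (≡-dec _≟_ _≟_) using (_∈?_)
open import Data.List.Relation.Unary.Unique.DecPropositional (≡-dec _≟_ _≟_) using (unique?)
open import Data.List.Relation.Unary.Unique.DecPropositional.Properties _≟_ using (deduplicate-!)

Unique⇒length≤ : ∀ {A : Set} → DecidableEquality A →
                 ∀ {xs ys : List A} → Unique xs → xs ⊆ ys → length xs ≤ length ys
Unique⇒length≤ _≟ₐ_ {[]}     _             _        = z≤n
Unique⇒length≤ _≟ₐ_ {x ∷ xs} {ys} (x≢xs ∷ !xs) x∷xs⊆ys = begin-strict
  length xs              ≤⟨ Unique⇒length≤ _≟ₐ_ !xs xs⊆ys-x ⟩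
  length (filter ≢x? ys) <⟨ filter-notAll ≢x? ys (Any.map (λ x≡y y≢x → y≢x (sym x≡y)) (x∷xs⊆ys (here refl))) ⟩
  length ys              ∎
  where
  open ≤-Reasoning
  ≢x? = λ y → ¬? (y ≟ₐ x)
  xs⊆ys-x : xs ⊆ filter ≢x? ys
  xs⊆ys-x y∈xs = ∈-filter⁺ ≢x? (x∷xs⊆ys (there y∈xs)) (λ y≡x → All.lookup x≢xs y∈xs (sym y≡x))

Unique⇒⊇ : ∀ {A : Set} → DecidableEquality A →
           ∀ {xs ys : List A} → Unique xs → xs ⊆ ys → length ys ≤ length xs → ys ⊆ xs
Unique⇒⊇ _≟ₐ_ {xs} {ys} !xs xs⊆ys ∣ys∣≤∣xs∣ {y} y∈ys with Any.any? (y ≟ₐ_) xs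
... | yes y∈xs = y∈xs
... | no  y∉xs = contradiction (≤-trans (Unique⇒length≤ _≟ₐ_ !y∷xs y∷xs⊆ys) ∣ys∣≤∣xs∣) (<-irrefl refl)
  where
  !y∷xs : Unique (y ∷ xs)
  !y∷xs = All.tabulate (λ x∈xs y≡x → y∉xs (subst (_∈ xs) (sym y≡x) x∈xs)) ∷ !xs
  y∷xs⊆ys : y ∷ xs ⊆ ys
  y∷xs⊆ys (here refl)  = y∈ys
  y∷xs⊆ys (there x∈xs) = xs⊆ys x∈xs

length-filter-map : ∀ {A B : Set} {P : B → Set} (P? : ∀ b → Dec (P b)) (f : A → B) xs →
                    length (filter (P? ∘ f) xs) ≡ length (filter P? (map f xs))
length-filter-map P? f []       = refl
length-filter-map P? f (x ∷ xs) with does (P? (f x))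
... | true  = cong suc (length-filter-map P? f xs)
... | false = length-filter-map P? f xs

*-length-filter≤sum : ∀ {A : Set} k (f : A → ℕ) xs → k * length (filter (λ x → k ≤? f x) xs) ≤ sum (map f xs)
*-length-filter≤sum k f []       = ≤-reflexive (*-zeroʳ k)
*-length-filter≤sum k f (x ∷ xs) with k ≤? f x
... | yes k≤fx rewrite filter-accept (λ y → k ≤? f y) {xs = xs} k≤fx =
  ≤-trans (≤-reflexive (*-suc k _)) (+-mono-≤ k≤fx (*-length-filter≤sum k f xs))
... | no  k≰fx rewrite filter-reject (λ y → k ≤? f y) {xs = xs} k≰fx =
  ≤-trans (*-length-filter≤sum k f xs) (m≤n+m _ (f x))

all-below : ∀ {n} {P : ℕ → Set} → All P (upTo n) → ∀ {k} → k < n → P k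
all-below all k<n = All.lookup all (∈-upTo⁺ k<n)

module _ {A : Set} {R : A → A → Set} (c : ℕ → A) {m : ℕ} {Cut : ℕ → Set} (Cut? : ∀ k → Dec (Cut k))
         (step : ∀ {k} → k < m → ¬ Cut k → R (c k) (c (suc k))) where

  arc : ∀ i d → i + d ≤ m → Star R (c i) (c (i + d)) ⊎ ∃[ k ] i ≤ k × k < i + d × Cut k
  arc i zero    _ rewrite +-identityʳ i = inj₁ ε
  arc i (suc d) i+1+d≤m rewrite +-suc i d with arc i d (<⇒≤ i+1+d≤m)
  ... | inj₂ (k , i≤k , k<i+d , cut) = inj₂ (k , i≤k , m<n⇒m<1+n k<i+d , cut)
  ... | inj₁ path with Cut? (i + d)
  ...   | yes cut  = inj₂ (i + d , m≤m+n i d , ≤-refl , cut)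
  ...   | no  ¬cut = inj₁ (path ◅◅ step i+1+d≤m ¬cut ◅ ε)

  cycle-connected : c m ≡ c 0 → Symmetric R → (∀ {k l} → k < m → l < m → Cut k → Cut l → k ≡ l) →
                    ∀ {i} → i < m → Star R (c 0) (c i)
  cycle-connected closed R-sym at-most-one {i} i<m with arc 0 i (<⇒≤ i<m)
  ... | inj₁ path = path
  ... | inj₂ (k , _ , k<i , cut-k) with arc i (m ∸ i) (≤-reflexive (m+[n∸m]≡n (<⇒≤ i<m)))
  ...   | inj₁ path = Star.reverse R-sym (subst (Star R (c i)) (trans (cong c (m+[n∸m]≡n (<⇒≤ i<m))) closed) path)
  ...   | inj₂ (l , i≤l , l<i+[m∸i] , cut-l) = contradiction
    (at-most-one (<-trans k<i i<m) (<-≤-trans l<i+[m∸i] (≤-reflexive (m+[n∸m]≡n (<⇒≤ i<m)))) cut-k cut-l)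
    (<⇒≢ (<-≤-trans k<i i≤l))

edge : ℕ → ℕ → ℕ × ℕ
edge u v = u ⊓ v , u ⊔ v

edge-comm : ∀ u v → edge u v ≡ edge v u
edge-comm u v = cong₂ _,_ (⊓-comm u v) (⊔-comm u v)

InF? : ∀ F u v → Dec (InF F u v)
InF? F u v = ((u , v) ∈? F) ⊎-dec ((v , u) ∈? F)

Reaches : ℕ → Graph → List (ℕ × ℕ) → ℕ → Set
Reaches m G F u = Σ (List ℕ) λ L → m ≤ length L × Unique L × All (λ w → IsVertex G w × Conn G F u w) L

module _ {G : Graph} {F : List (ℕ × ℕ)} where

  InF-sym : ∀ {u v} → InF F u v → InF F v u
  InF-sym (inj₁ uv∈F) = inj₂ uv∈F
  InF-sym (inj₂ vu∈F) = inj₁ vu∈F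

  InF⇒edge∈ : IsEdgeSet G F → ∀ {u v} → InF F u v → edge u v ∈ F
  InF⇒edge∈ (sorted , _) (inj₁ uv∈F) with All.lookup sorted uv∈F
  ... | _ , _ , refl , u<v , _ rewrite m≤n⇒m⊓n≡m (<⇒≤ u<v) | m≤n⇒m⊔n≡n (<⇒≤ u<v) = uv∈F
  InF⇒edge∈ (sorted , _) (inj₂ vu∈F) with All.lookup sorted vu∈F
  ... | _ , _ , refl , v<u , _ rewrite m≥n⇒m⊓n≡n (<⇒≤ v<u) | m≥n⇒m⊔n≡m (<⇒≤ v<u) = vu∈F

  AdjMinus-sym : Symmetric (Adj G) → Symmetric (AdjMinus G F)
  AdjMinus-sym Adj-sym (uv , uv∉F) = Adj-sym uv , uv∉F ∘ InF-sym

  Conn-sym : Symmetric (Adj G) → Symmetric (Conn G F)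
  Conn-sym Adj-sym = Star.reverse (AdjMinus-sym Adj-sym)

  Conn-closed : ∀ {S : List ℕ} → (∀ {x z} → x ∈ S → AdjMinus G F x z → z ∈ S) →
                ∀ {a b} → a ∈ S → Conn G F a b → b ∈ S
  Conn-closed closed a∈S ε         = a∈S
  Conn-closed closed a∈S (ab ◅ bc) = Conn-closed closed (closed a∈S ab) bc

  component-within : ∀ {m x S} → Reaches m G F x → IsVertex G x →
                     (∀ {w} → Conn G F x w → w ∈ S) → length S ≤ m → HasComponentOfSize m G F
  component-within {m} {x} {S} (L , m≤∣L∣ , !L , L↜x) x∈G x↝⊆S ∣S∣≤m =
    x , x∈G , L , ≤-antisym (≤-trans (Unique⇒length≤ _≟_ !L L⊆S) ∣S∣≤m) m≤∣L∣ , !L ,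
    λ w → mk⇔ (Unique⇒⊇ _≟_ !L L⊆S (≤-trans ∣S∣≤m m≤∣L∣) ∘ x↝⊆S) (proj₂ ∘ All.lookup L↜x)
    where
    L⊆S : L ⊆ S
    L⊆S = x↝⊆S ∘ proj₂ ∘ All.lookup L↜x

hits : List (ℕ × ℕ) → List (ℕ × ℕ) → ℕ
hits F xs = length (filter (_∈? F) xs)

module _ {F : List (ℕ × ℕ)} where

  hits-++ : ∀ xs ys → hits F (xs ++ ys) ≡ hits F xs + hits F ys
  hits-++ xs ys = trans (cong length (filter-++ (_∈? F) xs ys)) (length-++ (filter (_∈? F) xs))

  hits-concatMap : ∀ {A : Set} (f : A → List (ℕ × ℕ)) xs → hits F (concatMap f xs) ≡ sum (map (hits F ∘ f) xs)
  hits-concatMap f []       = refl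
  hits-concatMap f (x ∷ xs) = trans (hits-++ (f x) (concatMap f xs)) (cong (hits F (f x) +_) (hits-concatMap f xs))

  hits-∷ : ∀ x xs → hits F xs ≤ hits F (x ∷ xs)
  hits-∷ x xs with x ∈? F
  ... | yes _ = n≤1+n _
  ... | no  _ = ≤-refl

  hits-∷-∈ : ∀ {x} xs → x ∈ F → suc (hits F xs) ≤ hits F (x ∷ xs)
  hits-∷-∈ xs x∈F = ≤-reflexive (sym (cong length (filter-accept (_∈? F) x∈F)))

  hits-mono : ∀ {xs ys} → Unique xs → xs ⊆ ys → hits F xs ≤ hits F ys
  hits-mono !xs xs⊆ys = Unique⇒length≤ (≡-dec _≟_ _≟_) (Unique.filter⁺ (_∈? F) !xs) λ x∈ →
    let x∈xs , x∈F = ∈-filter⁻ (_∈? F) x∈ in ∈-filter⁺ (_∈? F) (xs⊆ys x∈xs) x∈F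

  hits≤∣F∣ : ∀ {xs} → Unique xs → hits F xs ≤ length F
  hits≤∣F∣ {xs} !xs =
    Unique⇒length≤ (≡-dec _≟_ _≟_) (Unique.filter⁺ (_∈? F) !xs) (proj₂ ∘ ∈-filter⁻ (_∈? F) {xs = xs})

  hits≥2 : ∀ {x y xs} → x ∈ xs → y ∈ xs → x ≢ y → x ∈ F → y ∈ F → 2 ≤ hits F xs
  hits≥2 x∈xs y∈xs x≢y x∈F y∈F = Unique⇒length≤ (≡-dec _≟_ _≟_) ((x≢y ∷ []) ∷ [] ∷ [])
    λ { (here refl) → ∈-filter⁺ (_∈? F) x∈xs x∈F ; (there (here refl)) → ∈-filter⁺ (_∈? F) y∈xs y∈F }

inCopy : ℕ → ℕ → ℕ × ℕ → ℕ × ℕ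
inCopy T i (x , y) = i * T + x , i * T + y

bridgeArcs : ℕ → ℕ → ℕ → List (ℕ × ℕ)
bridgeArcs T a b = (a * T + (b ∸ 1) , b * T + a) ∷ (b * T + a , a * T + (b ∸ 1)) ∷ []

bridgesInto : ℕ → ℕ → List (ℕ × ℕ)
bridgesInto T b = concatMap (λ a → bridgeArcs T a b) (upTo b)

arcs : ℕ → ℕ → List (ℕ × ℕ)
arcs zero    n = concatMap (λ u → map (u ,_) (filter (λ v → ¬? (u ≟ v)) (upTo n))) (upTo n)
arcs (suc k) n = concatMap (λ i → map (inCopy T i) (arcs k n)) (upTo (suc T))
              ++ concatMap (bridgesInto T) (upTo (suc T))
  where T = t k n

arcs-complete : ∀ {k n u v} → DAdj k n u v → (u , v) ∈ arcs k n
arcs-complete {n = n} (base u<n v<n u≢v) =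
  ∈-concatMap⁺ (λ u → map (u ,_) (filter (λ v → ¬? (u ≟ v)) (upTo n)))
               (lose (∈-upTo⁺ u<n) (∈-map⁺ _ (∈-filter⁺ _ (∈-upTo⁺ v<n) u≢v)))
arcs-complete {suc k} {n} (inner i≤T d) =
  ∈-++⁺ˡ (∈-concatMap⁺ (λ i → map (inCopy (t k n) i) (arcs k n))
                       (lose (∈-upTo⁺ (s≤s i≤T)) (∈-map⁺ _ (arcs-complete d))))
arcs-complete {suc k} {n} (cross {b = b} a<b b≤T) =
  ∈-++⁺ʳ _ (∈-concatMap⁺ (bridgesInto (t k n)) (lose (∈-upTo⁺ (s≤s b≤T))
    (∈-concatMap⁺ (λ a → bridgeArcs (t k n) a b) (lose (∈-upTo⁺ a<b) (here refl)))))
arcs-complete {suc k} {n} (cross' {b = b} a<b b≤T) =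
  ∈-++⁺ʳ _ (∈-concatMap⁺ (bridgesInto (t k n)) (lose (∈-upTo⁺ (s≤s b≤T))
    (∈-concatMap⁺ (λ a → bridgeArcs (t k n) a b) (lose (∈-upTo⁺ a<b) (there (here refl))))))

arcs-sound : ∀ k n {u v} → (u , v) ∈ arcs k n → DAdj k n u v
arcs-sound zero n uv∈
  with u , u∈ , v∈ ← find (∈-concatMap⁻ _ {xs = upTo n} uv∈)
  with v , v∈′ , refl ← ∈-map⁻ _ v∈
  with v∈n , u≢v ← ∈-filter⁻ _ {xs = upTo n} v∈′
  = base (∈-upTo⁻ u∈) (∈-upTo⁻ v∈n) u≢v
arcs-sound (suc k) n uv∈ with ∈-++⁻ _ uv∈
... | inj₁ inner∈
  with i , i∈ , shifted∈ ← find (∈-concatMap⁻ _ {xs = upTo (suc (t k n))} inner∈)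
  with (x , y) , xy∈ , refl ← ∈-map⁻ (inCopy (t k n) i) shifted∈
  = inner (s≤s⁻¹ (∈-upTo⁻ i∈)) (arcs-sound k n xy∈)
... | inj₂ cross∈
  with b , b∈ , ab∈ ← find (∈-concatMap⁻ _ {xs = upTo (suc (t k n))} cross∈)
  with a , a∈ , ab∈′ ← find (∈-concatMap⁻ (λ a → bridgeArcs (t k n) a b) {xs = upTo b} ab∈)
  = bridge-sound (∈-upTo⁻ a∈) (s≤s⁻¹ (∈-upTo⁻ b∈)) ab∈′
  where
  bridge-sound : ∀ {a b x y} → a < b → b ≤ t k n → (x , y) ∈ bridgeArcs (t k n) a b → DAdj (suc k) n x y
  bridge-sound a<b b≤T (here refl)         = cross a<b b≤T
  bridge-sound a<b b≤T (there (here refl)) = cross' a<b b≤T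

DAdj-sym : ∀ {k n u v} → DAdj k n u v → DAdj k n v u
DAdj-sym (base u<n v<n u≢v) = base v<n u<n (u≢v ∘ sym)
DAdj-sym (inner i≤T d)      = inner i≤T (DAdj-sym d)
DAdj-sym (cross a<b b≤T)    = cross' a<b b≤T
DAdj-sym (cross' a<b b≤T)   = cross a<b b≤T

cell< : ∀ {T i j} → i ≤ T → j < T → i * T + j < T * (T + 1)
cell< {T} {i} {j} i≤T j<T = begin-strict
  i * T + j   <⟨ +-monoʳ-< (i * T) j<T ⟩
  i * T + T   ≡⟨ +-comm (i * T) T ⟩
  suc i * T   ≤⟨ *-monoˡ-≤ T (s≤s i≤T) ⟩
  suc T * T   ≡⟨ *-comm (suc T) T ⟩
  T * suc T   ≡⟨ cong (T *_) (+-comm 1 T) ⟩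
  T * (T + 1) ∎
  where open ≤-Reasoning

DAdj⇒<t : ∀ {k n u v} → DAdj k n u v → v < t k n
DAdj⇒<t (base _ v<n _)               = v<n
DAdj⇒<t (inner i≤T d)                = cell< i≤T (DAdj⇒<t d)
DAdj⇒<t (cross a<b b≤T)              = cell< b≤T (<-≤-trans a<b b≤T)
DAdj⇒<t (cross' {b = suc b} a<b b<T) = cell< (<⇒≤ (<-≤-trans a<b b<T)) b<T

Conn-vertex : ∀ {k n F x w} → x < t k n → Conn (DCell k n) F x w → w < t k n
Conn-vertex x<t ε               = x<t
Conn-vertex _   ((xy , _) ◅ yw) = Conn-vertex (DAdj⇒<t xy) yw

port : ℕ → ℕ → ℕ
port a b with b <? a
... | yes _ = b
... | no  _ = b ∸ 1

port-< : ∀ {a b} → a < b → port a b ≡ b ∸ 1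
port-< {a} {b} a<b with b <? a
... | yes b<a = ⊥-elim (<-asym a<b b<a)
... | no  _   = refl

port-> : ∀ {a b} → b < a → port a b ≡ b
port-> {a} {b} b<a with b <? a
... | yes _   = refl
... | no  b≮a = ⊥-elim (b≮a b<a)

pred< : ∀ {T b} → 0 < b → b ≤ T → b ∸ 1 < T
pred< {b = suc b} _ b<T = b<T

port< : ∀ {T a b} → a ≢ b → a ≤ T → b ≤ T → port a b < T
port< {a = a} {b} a≢b a≤T b≤T with <-cmp a b
... | tri< a<b _ _ rewrite port-< a<b = pred< (≤-trans (s≤s z≤n) a<b) b≤T
... | tri≈ _ a≡b _ = ⊥-elim (a≢b a≡b)
... | tri> _ _ b<a rewrite port-> b<a = <-≤-trans b<a a≤T

bridge-adj : ∀ {k n a b} → a ≢ b → a ≤ t k n → b ≤ t k n →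
             DAdj (suc k) n (a * t k n + port a b) (b * t k n + port b a)
bridge-adj {a = a} {b} a≢b a≤T b≤T with <-cmp a b
... | tri< a<b _ _ rewrite port-< a<b | port-> a<b = cross a<b b≤T
... | tri≈ _ a≡b _ = ⊥-elim (a≢b a≡b)
... | tri> _ _ b<a rewrite port-> b<a | port-< b<a = cross' b<a a≤T

crossCopy : ℕ → ℕ → ℕ
crossCopy p j with j <? p
... | yes _ = j
... | no  _ = suc j

port-crossCopy : ∀ p j → port p (crossCopy p j) ≡ j
port-crossCopy p j with j <? p
... | yes j<p = port-> j<p
... | no  j≮p = port-< (s≤s (≮⇒≥ j≮p))

crossCopy≢ : ∀ p j → crossCopy p j ≢ p
crossCopy≢ p j with j <? p
... | yes j<p = <⇒≢ j<p
... | no  j≮p = λ sj≡p → j≮p (subst (j <_) sj≡p ≤-refl)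

crossCopy≤ : ∀ {T} p {j} → j < T → crossCopy p j ≤ T
crossCopy≤ p {j} j<T with j <? p
... | yes _ = <⇒≤ j<T
... | no  _ = j<T

leaves? : ∀ F u (e : ℕ × ℕ) → Dec (proj₁ e ≡ u × ¬ InF F (proj₁ e) (proj₂ e))
leaves? F u e = (proj₁ e ≟ u) ×-dec ¬? (InF? F (proj₁ e) (proj₂ e))

survivors : ∀ k n → List (ℕ × ℕ) → ℕ → List ℕ
survivors k n F u = map proj₂ (filter (leaves? F u) (arcs k n))

survivor-step : ∀ {k n F u z} → z ∈ survivors k n F u → AdjMinus (DCell k n) F u z
survivor-step {k} {n} {F} {u} z∈ with (x , z) , xz∈ , refl ← ∈-map⁻ proj₂ z∈
  with xz∈arcs , refl , uncut ← ∈-filter⁻ (leaves? F u) {xs = arcs k n} xz∈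
  = arcs-sound k n xz∈arcs , uncut

ball : ∀ k n → List (ℕ × ℕ) → ℕ → List ℕ
ball k n F u = deduplicate _≟_ (u ∷ concatMap (λ z → z ∷ survivors k n F z) (survivors k n F u))

ball-unique : ∀ {k n F u} → Unique (ball k n F u)
ball-unique {k} {n} {F} {u} = deduplicate-! (u ∷ concatMap (λ z → z ∷ survivors k n F z) (survivors k n F u))

ball-connected : ∀ {k n F u w} → w ∈ ball k n F u → Conn (DCell k n) F u w
ball-connected {k} {n} {F} {u} {w} w∈
  with ∈-deduplicate⁻ _≟_ (u ∷ concatMap (λ z → z ∷ survivors k n F z) (survivors k n F u)) w∈
... | here refl = ε
... | there w∈′ with z , z∈ , w∈z ← find (∈-concatMap⁻ (λ z → z ∷ survivors k n F z) {xs = survivors k n F u} w∈′)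
  = within-two z∈ w∈z
  where
  within-two : ∀ {z} → z ∈ survivors k n F u → w ∈ z ∷ survivors k n F z → Conn (DCell k n) F u w
  within-two z∈ (here refl)  = survivor-step z∈ ◅ ε
  within-two z∈ (there w∈sz) = survivor-step z∈ ◅ survivor-step w∈sz ◅ ε

D : Graph
D = DCell 2 2

cell : ℕ → ℕ → ℕ
cell p j = p * 6 + j

cells : List (ℕ × ℕ)
cells = cartesianProduct (upTo 7) (upTo 6)

cell-decompose : ∀ {w} → w < 42 → ∃[ p ] ∃[ j ] p < 7 × j < 6 × w ≡ cell p j
cell-decompose {w} w<42 =
  w / 6 , w % 6 , m<n*o⇒m/o<n w<42 , m%n<n w 6 , trans (m≡m%n+[m/n]*n w 6) (+-comm (w % 6) (w / 6 * 6))

hex : ℕ → ℕ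
hex 1 = 1
hex 2 = 4
hex 3 = 5
hex 4 = 3
hex 5 = 2
hex _ = 0

hexEdge : ℕ → ℕ → ℕ × ℕ
hexEdge p k = edge (cell p (hex k)) (cell p (hex (suc k)))

hexEdges : ℕ → List (ℕ × ℕ)
hexEdges p = map (hexEdge p) (upTo 6)

bridge : ℕ → ℕ → ℕ × ℕ
bridge a b = edge (cell a (port a b)) (cell b (port b a))

bridges : List (ℕ × ℕ)
bridges = concatMap (λ b → map (λ a → bridge a b) (upTo b)) (upTo 7)

edgesD : List (ℕ × ℕ)
edgesD = concatMap hexEdges (upTo 7) ++ bridges

bridge∈bridges : ∀ {a b} → a ≢ b → a < 7 → b < 7 → bridge a b ∈ bridges
bridge∈bridges {a} {b} a≢b a<7 b<7 with <-cmp a b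
... | tri< a<b _ _ =
  ∈-concatMap⁺ (λ b → map (λ a → bridge a b) (upTo b)) (lose (∈-upTo⁺ b<7) (∈-map⁺ _ (∈-upTo⁺ a<b)))
... | tri≈ _ a≡b _ = ⊥-elim (a≢b a≡b)
... | tri> _ _ b<a = subst (_∈ bridges) (edge-comm _ _)
  (∈-concatMap⁺ (λ a → map (λ b → bridge b a) (upTo a)) (lose (∈-upTo⁺ a<7) (∈-map⁺ _ (∈-upTo⁺ b<a))))

bridgeAt : ℕ × ℕ → ℕ × ℕ
bridgeAt (p , j) = bridge p (crossCopy p j)

bridgeAt∈bridges : ∀ {c} → c ∈ cells → bridgeAt c ∈ bridges
bridgeAt∈bridges {p , j} c∈cells with p∈ , j∈ ← ∈-cartesianProduct⁻ (upTo 7) (upTo 6) c∈cells =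
  bridge∈bridges (crossCopy≢ p j ∘ sym) (∈-upTo⁻ p∈) (s≤s (crossCopy≤ p (∈-upTo⁻ j∈)))

routes : ℕ → ℕ → List ℕ → List (ℕ × ℕ)
routes r p []       = bridge r p ∷ []
routes r p (c ∷ cs) = bridge r c ∷ bridge c p ∷ routes r p cs

hubs : ℕ → ℕ → List ℕ
hubs r p = filter (λ c → ¬? (c ≟ r) ×-dec ¬? (c ≟ p)) (upTo 7)

Hub : ℕ → ℕ → ℕ → Set
Hub r p c = c < 7 × c ≢ r × c ≢ p

hubs-ok : ∀ r p → All (Hub r p) (hubs r p)
hubs-ok r p = All.tabulate λ c∈ →
  let c∈upTo , c≢r , c≢p = ∈-filter⁻ (λ c → ¬? (c ≟ r) ×-dec ¬? (c ≟ p)) {xs = upTo 7} c∈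
  in ∈-upTo⁻ c∈upTo , c≢r , c≢p

hubs-unique : ∀ r p → Unique (hubs r p)
hubs-unique r p = Unique.filter⁺ (λ c → ¬? (c ≟ r) ×-dec ¬? (c ≟ p)) (Unique.upTo⁺ 7)

routes⊆bridges : ∀ {r p cs} → r < 7 → p < 7 → r ≢ p → All (Hub r p) cs → routes r p cs ⊆ bridges
routes⊆bridges r<7 p<7 r≢p []                    (here refl)         = bridge∈bridges r≢p r<7 p<7
routes⊆bridges r<7 p<7 r≢p ((c<7 , c≢r , _) ∷ _) (here refl)         = bridge∈bridges (c≢r ∘ sym) r<7 c<7
routes⊆bridges r<7 p<7 r≢p ((c<7 , _ , c≢p) ∷ _) (there (here refl)) = bridge∈bridges c≢p c<7 p<7
routes⊆bridges r<7 p<7 r≢p (_ ∷ cs-ok)           (there (there e∈))  = routes⊆bridges r<7 p<7 r≢p cs-ok e∈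

links : List ℕ → List (ℕ × ℕ)
links U = filter (λ (p , j) → (p ∈ℕ? U) ×-dec (crossCopy p j ∈ℕ? U)) cells

outlets : List ℕ → List (ℕ × ℕ)
outlets U = filter (λ (p , j) → (p ∈ℕ? U) ×-dec ¬? (crossCopy p j ∈ℕ? U)) cells

∈-links : ∀ {U p j} → p < 7 → j < 6 → p ∈ U → crossCopy p j ∈ U → (p , j) ∈ links U
∈-links {U} p<7 j<6 p∈U q∈U = ∈-filter⁺ (λ (p , j) → (p ∈ℕ? U) ×-dec (crossCopy p j ∈ℕ? U))
  (∈-cartesianProduct⁺ (∈-upTo⁺ p<7) (∈-upTo⁺ j<6)) (p∈U , q∈U)

∈-outlets : ∀ {U p j} → p < 7 → j < 6 → p ∈ U → crossCopy p j ∉ U → (p , j) ∈ outlets U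
∈-outlets {U} p<7 j<6 p∈U q∉U = ∈-filter⁺ (λ (p , j) → (p ∈ℕ? U) ×-dec ¬? (crossCopy p j ∈ℕ? U))
  (∈-cartesianProduct⁺ (∈-upTo⁺ p<7) (∈-upTo⁺ j<6)) (p∈U , q∉U)

outlets⊆cells : ∀ {U} → outlets U ⊆ cells
outlets⊆cells {U} = proj₁ ∘ ∈-filter⁻ (λ (p , j) → (p ∈ℕ? U) ×-dec ¬? (crossCopy p j ∈ℕ? U)) {xs = cells}

-- For a set U of heavy copies, at most 5 ∸ 2 * length U bridges are cut, and a vertex is stranded
-- when it is a link or an outlet whose bridge is cut.
FewStranded : List ℕ → Set
FewStranded U = Unique (map bridgeAt (outlets U)) × length (links U) + (5 ∸ 2 * length U) ⊓ length (outlets U) ≤ 3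

smallSets : List (List ℕ)
smallSets = [] ∷ map [_] (upTo 7) ++ cartesianProductWith (λ a b → a ∷ b ∷ []) (upTo 7) (upTo 7)

small∈smallSets : ∀ {U} → All (_< 7) U → length U ≤ 2 → U ∈ smallSets
small∈smallSets []               _ = here refl
small∈smallSets (a<7 ∷ [])       _ = there (∈-++⁺ˡ (∈-map⁺ [_] (∈-upTo⁺ a<7)))
small∈smallSets (a<7 ∷ b<7 ∷ []) _ =
  there (∈-++⁺ʳ (map [_] (upTo 7)) (∈-cartesianProductWith⁺ (λ a b → a ∷ b ∷ []) (∈-upTo⁺ a<7) (∈-upTo⁺ b<7)))
small∈smallSets (_ ∷ _ ∷ _ ∷ _) (s≤s (s≤s ()))

-- The finite checks below are opaque: unfolding such a certificate, e.g. during with-abstraction,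
-- makes type checking blow up.
opaque
  hex-adj : ∀ {k} → k < 6 → DAdj 1 2 (hex k) (hex (suc k))
  hex-adj k<6 =
    arcs-sound 1 2 (all-below (from-yes (All.all? (λ k → (hex k , hex (suc k)) ∈? arcs 1 2) (upTo 6))) k<6)

  hex-onto : ∀ {j} → j < 6 → ∃[ k ] k < 6 × hex k ≡ j
  hex-onto j<6
    with k , k∈ , hexk≡j ← find (all-below (from-yes (All.all? (λ j → Any.any? (λ k → hex k ≟ j) (upTo 6)) (upTo 6))) j<6)
    = k , ∈-upTo⁻ k∈ , hexk≡j

  hexEdge-injective : ∀ {p k l} → p < 7 → k < 6 → l < 6 → hexEdge p k ≡ hexEdge p l → k ≡ l
  hexEdge-injective p<7 k<6 l<6 = all-below (all-below (all-below (from-yes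
    (All.all? (λ p → All.all? (λ k → All.all? (λ l → ≡-dec _≟_ _≟_ (hexEdge p k) (hexEdge p l) →-dec (k ≟ l))
       (upTo 6)) (upTo 6)) (upTo 7))) p<7) k<6) l<6

  edgesD-unique : Unique edgesD
  edgesD-unique = from-yes (unique? edgesD)

  routes-unique : ∀ {r p} → r < 7 → p < 7 → r ≢ p → Unique (routes r p (hubs r p))
  routes-unique r<7 p<7 = all-below (all-below (from-yes
    (All.all? (λ r → All.all? (λ p → ¬? (r ≟ p) →-dec unique? (routes r p (hubs r p))) (upTo 7)) (upTo 7))) r<7) p<7

  ∣hubs∣≡5 : ∀ {r p} → r < 7 → p < 7 → r ≢ p → length (hubs r p) ≡ 5
  ∣hubs∣≡5 r<7 p<7 = all-below (all-below (from-yes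
    (All.all? (λ r → All.all? (λ p → ¬? (r ≟ p) →-dec (length (hubs r p) ≟ 5)) (upTo 7)) (upTo 7))) r<7) p<7

  few-stranded : ∀ {U} → U ∈ smallSets → FewStranded U
  few-stranded = All.lookup (from-yes (All.all? (λ U → unique? (map bridgeAt (outlets U)) ×-dec
    (length (links U) + (5 ∸ 2 * length U) ⊓ length (outlets U) ≤? 3)) smallSets))

-- Cuts with at most five edges

module SmallCut (F : List (ℕ × ℕ)) (F-edges : IsEdgeSet D F) (∣F∣≤5 : length F ≤ 5) where

  load : ℕ → ℕ
  load p = hits F (hexEdges p)

  opaque
    heavy : List ℕ
    heavy = filter (λ p → 2 ≤? load p) (upTo 7)

    ∈-heavy⁺ : ∀ {p} → p < 7 → 2 ≤ load p → p ∈ heavy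
    ∈-heavy⁺ p<7 = ∈-filter⁺ (λ p → 2 ≤? load p) (∈-upTo⁺ p<7)

    heavy<7 : All (_< 7) heavy
    heavy<7 = All.tabulate (∈-upTo⁻ ∘ proj₁ ∘ ∈-filter⁻ (λ p → 2 ≤? load p) {xs = upTo 7})

    2*∣heavy∣≤Σload : 2 * length heavy ≤ sum (map load (upTo 7))
    2*∣heavy∣≤Σload = *-length-filter≤sum 2 load (upTo 7)

  Light : ℕ → Set
  Light p = p < 7 × p ∉ heavy

  budget : hits F bridges + 2 * length heavy ≤ 5
  budget = begin
    hits F bridges + 2 * length heavy                     ≤⟨ +-monoʳ-≤ (hits F bridges) 2*∣heavy∣≤Σload ⟩
    hits F bridges + sum (map load (upTo 7))              ≡⟨ +-comm (hits F bridges) _ ⟩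
    sum (map load (upTo 7)) + hits F bridges              ≡⟨ cong (_+ hits F bridges) (hits-concatMap {F = F} hexEdges (upTo 7)) ⟨
    hits F (concatMap hexEdges (upTo 7)) + hits F bridges ≡⟨ hits-++ {F = F} (concatMap hexEdges (upTo 7)) bridges ⟨
    hits F edgesD                                         ≤⟨ hits≤∣F∣ {F = F} edgesD-unique ⟩
    length F                                              ≤⟨ ∣F∣≤5 ⟩
    5                                                     ∎
    where open ≤-Reasoning

  ∣heavy∣≤2 : length heavy ≤ 2
  ∣heavy∣≤2 = ≮⇒≥ λ 2<∣heavy∣ →
    ≤⇒≯ budget (≤-trans (*-monoʳ-≤ 2 2<∣heavy∣) (m≤n+m (2 * length heavy) (hits F bridges)))

  some-light : ∃[ r ] Light r
  some-light with toSum (All.all? (_∈ℕ? heavy) (upTo 7))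
  ... | inj₁ all-heavy = ⊥-elim (≤⇒≯ ∣heavy∣≤2
    (≤-trans (s≤s (s≤s (s≤s z≤n))) (Unique⇒length≤ _≟_ (Unique.upTo⁺ 7) (All.lookup all-heavy))))
  ... | inj₂ not-all-heavy with r , r∈upTo , r∉heavy ← find (¬All⇒Any¬ (_∈ℕ? heavy) (upTo 7) not-all-heavy)
    = r , ∈-upTo⁻ r∈upTo , r∉heavy

  Conn-D-sym : Symmetric (Conn D F)
  Conn-D-sym = Conn-sym {G = D} DAdj-sym

  uncut-edge : ∀ {u v} → edge u v ∉ F → ¬ InF F u v
  uncut-edge e∉F = e∉F ∘ InF⇒edge∈ {G = D} F-edges

  light-copy-connected : ∀ {p} → Light p → ∀ {j} → j < 6 → Conn D F (cell p 0) (cell p j)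
  light-copy-connected {p} (p<7 , p∉heavy) j<6 with k , k<6 , refl ← hex-onto j<6 =
    cycle-connected (cell p ∘ hex) (λ k → InF? F (cell p (hex k)) (cell p (hex (suc k))))
      (λ k<6 uncut → inner (s≤s⁻¹ p<7) (hex-adj k<6) , uncut) refl (AdjMinus-sym {G = D} {F} DAdj-sym) at-most-one-cut k<6
    where
    Cut : ℕ → Set
    Cut k = InF F (cell p (hex k)) (cell p (hex (suc k)))
    at-most-one-cut : ∀ {k l} → k < 6 → l < 6 → Cut k → Cut l → k ≡ l
    at-most-one-cut {k} {l} k<6 l<6 cut-k cut-l with k ≟ l
    ... | yes k≡l = k≡l
    ... | no  k≢l = ⊥-elim (p∉heavy (∈-heavy⁺ p<7 (hits≥2
          (∈-map⁺ (hexEdge p) (∈-upTo⁺ k<6)) (∈-map⁺ (hexEdge p) (∈-upTo⁺ l<6)) (k≢l ∘ hexEdge-injective p<7 k<6 l<6)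
          (InF⇒edge∈ {G = D} F-edges cut-k) (InF⇒edge∈ {G = D} F-edges cut-l))))

  bridge-step : ∀ {a b} → a ≢ b → a < 7 → b < 7 → bridge a b ∉ F →
                AdjMinus D F (cell a (port a b)) (cell b (port b a))
  bridge-step a≢b a<7 b<7 b∉F = bridge-adj a≢b (s≤s⁻¹ a<7) (s≤s⁻¹ b<7) , uncut-edge b∉F

  Linked : ℕ → ℕ → Set
  Linked a b = Conn D F (cell a 0) (cell b 0)

  linked-by-bridge : ∀ {a b} → Light a → Light b → a ≢ b → bridge a b ∉ F → Linked a b
  linked-by-bridge la@(a<7 , _) lb@(b<7 , _) a≢b b∉F =
    light-copy-connected la (port< a≢b (s≤s⁻¹ a<7) (s≤s⁻¹ b<7)) ◅◅
    bridge-step a≢b a<7 b<7 b∉F ◅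
    Conn-D-sym (light-copy-connected lb (port< (a≢b ∘ sym) (s≤s⁻¹ b<7) (s≤s⁻¹ a<7)))

  routes-hits : ∀ r p c cs → hits F (routes r p cs) ≤ hits F (routes r p (c ∷ cs))
  routes-hits r p c cs =
    ≤-trans (hits-∷ {F = F} (bridge c p) (routes r p cs)) (hits-∷ {F = F} (bridge r c) (bridge c p ∷ routes r p cs))

  routes-hits-cut : ∀ r p c cs → bridge r c ∈ F ⊎ bridge c p ∈ F →
                    suc (hits F (routes r p cs)) ≤ hits F (routes r p (c ∷ cs))
  routes-hits-cut r p c cs (inj₁ rc∈F) = ≤-trans (s≤s (hits-∷ {F = F} (bridge c p) (routes r p cs))) (hits-∷-∈ _ rc∈F)
  routes-hits-cut r p c cs (inj₂ cp∈F) =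
    ≤-trans (hits-∷-∈ (routes r p cs) cp∈F) (hits-∷ {F = F} (bridge r c) (bridge c p ∷ routes r p cs))

  -- The route r – c – p through a hub c is blocked only by a cut bridge or by c being heavy.
  -- Decisions are taken through toSum: abstracting  bridge r p ∈? F  itself would also rewrite the
  -- hits count in the goal.
  relay : ∀ {r p} cs → Light r → Light p → r ≢ p → All (Hub r p) cs →
          Linked r p ⊎ suc (length cs) ≤ hits F (routes r p cs) + length (filter (_∈ℕ? heavy) cs)
  relay {r} {p} [] lr lp r≢p [] with toSum (bridge r p ∈? F)
  ... | inj₁ b∈F = inj₂ (≤-trans (hits-∷-∈ [] b∈F) (m≤m+n _ _))
  ... | inj₂ b∉F = inj₁ (linked-by-bridge lr lp r≢p b∉F)
  relay {r} {p} (c ∷ cs) lr lp r≢p ((c<7 , c≢r , c≢p) ∷ cs-ok) with relay cs lr lp r≢p cs-ok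
  ... | inj₁ linked = inj₁ linked
  ... | inj₂ blocked with c ∈ℕ? heavy
  ...   | yes c∈heavy =
    inj₂ (≤-trans (s≤s blocked) (≤-trans (≤-reflexive (sym (+-suc _ _))) (+-monoˡ-≤ _ (routes-hits r p c cs))))
  ...   | no  c∉heavy with toSum ((bridge r c ∈? F) ⊎-dec (bridge c p ∈? F))
  ...     | inj₁ cut   = inj₂ (≤-trans (s≤s blocked) (+-monoˡ-≤ _ (routes-hits-cut r p c cs cut)))
  ...     | inj₂ uncut = inj₁ (linked-by-bridge lr (c<7 , c∉heavy) (c≢r ∘ sym) (uncut ∘ inj₁) ◅◅
                              linked-by-bridge (c<7 , c∉heavy) lp c≢p (uncut ∘ inj₂))

  light-linked : ∀ {r p} → Light r → Light p → Linked r p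
  light-linked {r} {p} lr@(r<7 , _) lp@(p<7 , _) with r ≟ p
  ... | yes refl = ε
  ... | no  r≢p with relay (hubs r p) lr lp r≢p (hubs-ok r p)
  ...   | inj₁ linked  = linked
  ...   | inj₂ blocked = ⊥-elim (≤⇒≯ budget (begin-strict
    5                                                                    ≡⟨ ∣hubs∣≡5 r<7 p<7 r≢p ⟨
    length (hubs r p)                                                    <⟨ blocked ⟩
    hits F (routes r p (hubs r p)) + length (filter (_∈ℕ? heavy) (hubs r p))
      ≤⟨ +-mono-≤ (hits-mono (routes-unique r<7 p<7 r≢p) (routes⊆bridges r<7 p<7 r≢p (hubs-ok r p))) heavy-hubs≤ ⟩
    hits F bridges + length heavy     ≤⟨ +-monoʳ-≤ (hits F bridges) (m≤m+n _ (length heavy + 0)) ⟩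
    hits F bridges + 2 * length heavy ∎))
    where
    open ≤-Reasoning
    heavy-hubs≤ : length (filter (_∈ℕ? heavy) (hubs r p)) ≤ length heavy
    heavy-hubs≤ = Unique⇒length≤ _≟_ (Unique.filter⁺ (_∈ℕ? heavy) (hubs-unique r p))
                                     (proj₂ ∘ ∈-filter⁻ (_∈ℕ? heavy) {xs = hubs r p})

  severed : List (ℕ × ℕ)
  severed = filter (λ c → bridgeAt c ∈? F) (outlets heavy)

  stranded : List ℕ
  stranded = map (uncurry cell) (links heavy ++ severed)

  stranded-few : length stranded ≤ 3
  stranded-few = begin
    length stranded                       ≡⟨ length-map (uncurry cell) (links heavy ++ severed) ⟩
    length (links heavy ++ severed)       ≡⟨ length-++ (links heavy) ⟩
    length (links heavy) + length severed
      ≤⟨ +-monoʳ-≤ (length (links heavy)) (⊓-glb ∣severed∣≤5∸2∣heavy∣ ∣severed∣≤∣outlets∣) ⟩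
    length (links heavy) + (5 ∸ 2 * length heavy) ⊓ length (outlets heavy) ≤⟨ proj₂ few ⟩
    3                                                                        ∎
    where
    open ≤-Reasoning
    few : FewStranded heavy
    few = few-stranded (small∈smallSets heavy<7 ∣heavy∣≤2)
    ∣severed∣≤∣outlets∣ : length severed ≤ length (outlets heavy)
    ∣severed∣≤∣outlets∣ = length-filter (λ c → bridgeAt c ∈? F) (outlets heavy)
    severed-bridges⊆bridges : map bridgeAt (outlets heavy) ⊆ bridges
    severed-bridges⊆bridges b∈ with c , c∈ , refl ← ∈-map⁻ bridgeAt b∈ = bridgeAt∈bridges (outlets⊆cells {heavy} c∈)
    ∣severed∣≤5∸2∣heavy∣ : length severed ≤ 5 ∸ 2 * length heavy
    ∣severed∣≤5∸2∣heavy∣ = m+n≤o⇒m≤o∸n (length severed) (begin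
      length severed + 2 * length heavy
        ≡⟨ cong (_+ 2 * length heavy) (length-filter-map (_∈? F) bridgeAt (outlets heavy)) ⟩
      hits F (map bridgeAt (outlets heavy)) + 2 * length heavy
        ≤⟨ +-monoˡ-≤ (2 * length heavy) (hits-mono (proj₁ few) severed-bridges⊆bridges) ⟩
      hits F bridges + 2 * length heavy ≤⟨ budget ⟩
      5                                 ∎)

  module Anchored {r₀} (light-r₀ : Light r₀) where

    w₀ : ℕ
    w₀ = cell r₀ 0

    light-joined : ∀ {p} → Light p → ∀ {j} → j < 6 → Conn D F (cell p j) w₀
    light-joined lp j<6 = Conn-D-sym (light-linked light-r₀ lp ◅◅ light-copy-connected lp j<6)

    joined-or-stranded : ∀ {p j} → p < 7 → j < 6 → Conn D F (cell p j) w₀ ⊎ cell p j ∈ stranded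
    joined-or-stranded {p} {j} p<7 j<6 with toSum (p ∈ℕ? heavy)
    ... | inj₂ p∉heavy = inj₁ (light-joined (p<7 , p∉heavy) j<6)
    ... | inj₁ p∈heavy with toSum (crossCopy p j ∈ℕ? heavy)
    ...   | inj₁ q∈heavy = inj₂ (∈-map⁺ (uncurry cell) (∈-++⁺ˡ (∈-links p<7 j<6 p∈heavy q∈heavy)))
    ...   | inj₂ q∉heavy with toSum (bridgeAt (p , j) ∈? F)
    ...     | inj₁ b∈F = inj₂ (∈-map⁺ (uncurry cell) (∈-++⁺ʳ (links heavy)
                           (∈-filter⁺ (λ c → bridgeAt c ∈? F) (∈-outlets p<7 j<6 p∈heavy q∉heavy) b∈F)))
    ...     | inj₂ b∉F = inj₁ (subst (λ j → Conn D F (cell p j) w₀) (port-crossCopy p j)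
                           (bridge-step (crossCopy≢ p j ∘ sym) p<7 q<7 b∉F ◅
                            light-joined (q<7 , q∉heavy) (port< (crossCopy≢ p j) (s≤s⁻¹ q<7) (s≤s⁻¹ p<7))))
      where q<7 = s≤s (crossCopy≤ p j<6)

    vertex-joined-or-stranded : ∀ {w} → w < 42 → Conn D F w w₀ ⊎ w ∈ stranded
    vertex-joined-or-stranded w<42 with p , j , p<7 , j<6 , refl ← cell-decompose w<42 = joined-or-stranded p<7 j<6

    unstranded-joined : ∀ {w} → w < 42 → w ∉ stranded → Conn D F w w₀
    unstranded-joined w<42 w∉ with vertex-joined-or-stranded w<42
    ... | inj₁ w↝w₀ = w↝w₀
    ... | inj₂ w∈   = contradiction w∈ w∉

    -- If the three vertices reached from x are all stranded, then they are all the stranded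
    -- vertices; so if x were joined to w₀, every vertex would be.
    isolated-or-joined : ComponentsAtLeast 3 D F → ¬ (∀ {y} → y < 42 → Conn D F y w₀) →
                         ∀ {x} → x < 42 → HasComponentOfSize 3 D F ⊎ Conn D F x w₀
    isolated-or-joined atLeast not-all-joined {x} x<42 = decide (atLeast x x<42)
      where
      decide : Reaches 3 D F x → HasComponentOfSize 3 D F ⊎ Conn D F x w₀
      decide reach@(L , 3≤∣L∣ , !L , L↜x) with toSum (All.all? (_∈ℕ? stranded) L)
      ... | inj₂ L⊈stranded with w , w∈L , w∉ ← find (¬All⇒Any¬ (_∈ℕ? stranded) L L⊈stranded)
        = let w<42 , x↝w = All.lookup L↜x w∈L in inj₂ (x↝w ◅◅ unstranded-joined w<42 w∉)
      ... | inj₁ L⊆stranded = inj₁ (component-within reach x<42 stays-stranded stranded-few)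
        where
        stranded⊆L : stranded ⊆ L
        stranded⊆L = Unique⇒⊇ _≟_ !L (All.lookup L⊆stranded) (≤-trans stranded-few 3≤∣L∣)
        all-joined : Conn D F x w₀ → ∀ {y} → y < 42 → Conn D F y w₀
        all-joined x↝w₀ y<42 with vertex-joined-or-stranded y<42
        ... | inj₁ y↝w₀ = y↝w₀
        ... | inj₂ y∈   = Conn-D-sym (proj₂ (All.lookup L↜x (stranded⊆L y∈))) ◅◅ x↝w₀
        stays-stranded : ∀ {w} → Conn D F x w → w ∈ stranded
        stays-stranded x↝w with vertex-joined-or-stranded (Conn-vertex x<42 x↝w)
        ... | inj₁ w↝w₀ = ⊥-elim (not-all-joined (all-joined (x↝w ◅◅ w↝w₀)))
        ... | inj₂ w∈   = w∈

    isolated : Disconnected D F → ComponentsAtLeast 3 D F → HasComponentOfSize 3 D F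
    isolated (u , v , u<42 , v<42 , u↮v) atLeast = decide (isolated-or-joined′ u<42) (isolated-or-joined′ v<42)
      where
      isolated-or-joined′ : ∀ {x} → x < 42 → HasComponentOfSize 3 D F ⊎ Conn D F x w₀
      isolated-or-joined′ =
        isolated-or-joined atLeast λ all-joined → u↮v (all-joined u<42 ◅◅ Conn-D-sym (all-joined v<42))
      decide : HasComponentOfSize 3 D F ⊎ Conn D F u w₀ → HasComponentOfSize 3 D F ⊎ Conn D F v w₀ →
               HasComponentOfSize 3 D F
      decide (inj₁ found) _            = found
      decide (inj₂ _)     (inj₁ found) = found
      decide (inj₂ u↝w₀)  (inj₂ v↝w₀)  = ⊥-elim (u↮v (u↝w₀ ◅◅ Conn-D-sym v↝w₀))

  isolated : Disconnected D F → ComponentsAtLeast 3 D F → HasComponentOfSize 3 D F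
  isolated = Anchored.isolated (proj₂ some-light)

-- The five edges leaving the path 0 – 1 – 4

F₀ : List (ℕ × ℕ)
F₀ = (0 , 2) ∷ (4 , 5) ∷ (0 , 6) ∷ (1 , 12) ∷ (4 , 30) ∷ []

path₀ : List ℕ
path₀ = 0 ∷ 1 ∷ 4 ∷ []

F₀-edges : IsEdgeSet D F₀
F₀-edges = All.map (λ (u<v , uv∈arcs) → _ , _ , refl , u<v , arcs-sound 2 2 uv∈arcs)
                   (from-yes (All.all? (λ e → (proj₁ e <? proj₂ e) ×-dec (e ∈? arcs 2 2)) F₀))
         , from-yes (unique? F₀)

opaque
  path₀-boundary : All (λ e → proj₁ e ∉ path₀ ⊎ proj₂ e ∈ path₀ ⊎ InF F₀ (proj₁ e) (proj₂ e)) (arcs 2 2)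
  path₀-boundary = from-yes
    (All.all? (λ e → ¬? (proj₁ e ∈ℕ? path₀) ⊎-dec (proj₂ e ∈ℕ? path₀) ⊎-dec InF? F₀ (proj₁ e) (proj₂ e)) (arcs 2 2))

  balls₀-large : ∀ {u} → u < 42 → 3 ≤ length (ball 2 2 F₀ u)
  balls₀-large = all-below (from-yes (All.all? (λ u → 3 ≤? length (ball 2 2 F₀ u)) (upTo 42)))

path₀-closed : ∀ {x z} → x ∈ path₀ → AdjMinus D F₀ x z → z ∈ path₀
path₀-closed x∈ (xz , uncut) with All.lookup path₀-boundary (arcs-complete xz)
... | inj₁ x∉         = contradiction x∈ x∉
... | inj₂ (inj₁ z∈)  = z∈
... | inj₂ (inj₂ cut) = contradiction cut uncut

F₀-cut : RestrictedEdgeCut 3 D F₀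
F₀-cut = F₀-edges , disconnected₀ , reaches₀
  where
  disconnected₀ : Disconnected D F₀
  disconnected₀ = 0 , 5 , from-yes (0 <? 42) , from-yes (5 <? 42) ,
                  from-yes (¬? (5 ∈ℕ? path₀)) ∘ Conn-closed {G = D} path₀-closed (here refl)
  reaches₀ : ComponentsAtLeast 3 D F₀
  reaches₀ u u<42 =
    ball 2 2 F₀ u , balls₀-large u<42 , ball-unique {2} {2} {F₀} ,
    All.tabulate λ w∈ball → let u↝w = ball-connected {2} {2} {F₀} w∈ball in Conn-vertex u<42 u↝w , u↝w

lemma13 : SuperLambda 3 (DCell 2 2)
lemma13 F ((F-edges , disconnected , atLeast) , minimum) =
  SmallCut.isolated F F-edges (minimum F₀ F₀-cut) disconnected atLeast
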